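{- The CI frames $\mathfrak{S}^{\mathrm{str}}$ (structural semi-graphoids) and $\mathfrak{S}$ (semi-graphoids) are closed under tight replication.
   Context: For a finite set $N$, $\mathbb{S}(N)$ denotes the set of all CI statements $ij|K$ with $i,j\in N$ distinct and $K\subseteq N\setminus\{i,j\}$, with $ij|K$ and $ji|K$ identified; juxtaposition denotes union. A CI model over $N$ is a subset of $\mathbb{S}(N)$. A CI frame $\mathfrak{F}$ assigns to every finite set $N$ a set $\mathfrak{F}(N)$ of models over $N$ with $\mathbb{S}(N)\in\mathfrak{F}(N)$. $\mathfrak{S}^{\mathrm{str}}(N)$: models $\{ij|K:\Delta m(ij|K)=0\}$ for supermodular $m:\mathcal{P}(N)\to\mathbb{R}$, where $\Delta m(ij|K)=m(ijK)+m(K)-m(iK)-m(jK)$ and supermodular means $m(A\cup B)+m(A\cap B)\ge m(A)+m(B)$ for all $A,B\subseteq N$. $\mathfrak{S}(N)$: semi-graphoids, i.e. $\mathcal{M}\subseteq\mathbb{S}(N)$ such that for distinct $i,j,\ell$ and $K\subseteq N\setminus\{i,j,\ell\}$: $ij|K,\ i\ell|jK\in\mathcal{M}\iff i\ell|K,\ ij|\ell K\in\mathcal{M}$. For pairwise disjoint $I,J,C$, $I\perp J\,|\,C\,[\mathcal{M}]$ means $ij|L'\in\mathcal{M}$ for all $i\in I$, $j\in J$, $C\subseteq L'\subseteq(I\cup J\cup C)\setminus\{i,j\}$. Tight replication: let $N,M$ be finite sets with $|N|=|M|=n\ge1$ and $|N\cap M|=n-1$; put $L=N\cap M$, let $u$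 be the element of $N\setminus L$ and $v$ the element of $M\setminus L$, and let $\rho:N\cup M\to N$ be $\rho(i)=i$ for $i\in N$, $\rho(v)=u$. For $\mathcal{M}\subseteq\mathbb{S}(N)$, the model $\mathcal{M}_{v\|u}\subseteq\mathbb{S}(N\cup M)$ consists of those $ij|K\in\mathbb{S}(N\cup M)$ such that $\rho(i)\perp\rho(j)\,|\,\rho(K)\,[\mathcal{M}]$ holds, under the conventions: (1) $a\perp b\,|\,C\,[\mathcal{M}]$ holds whenever $\{a,b\}\cap C\neq\emptyset$; (2) for $C\subseteq L$, $u\perp u\,|\,C\,[\mathcal{M}]$ means $\{u\}\perp(L\setminus C)\,|\,C\,[\mathcal{M}]$; otherwise ($\rho(i)\ne\rho(j)$, both outside $\rho(K)$) it means $\rho(i)\rho(j)|\rho(K)\in\mathcal{M}$. A frame $\mathfrak{F}$ is closed under tight replication if for all such $N,M$ and all $\mathcal{M}\in\mathfrak{F}(N)$ one has $\mathcal{M}_{v\|u}\in\mathfrak{F}(N\cup M)$.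
   Formalization: The supermodular functions $m$ that define structural semi-graphoids take values in the rationals rather than the reals. -}

module Defs where

open import Data.Nat using (ℕ)
open import Data.Fin using (Fin; _≟_)
open import Data.Fin.Subset
  using (Subset; _∈_; _∉_; _⊆_; _∩_; _∪_; _─_; _-_; ⁅_⁆)
  renaming (⊥ to ∅)
open import Data.Fin.Subset.Properties using (_∈?_)
open import Data.Rational using (ℚ; 0ℚ; _+_; _≤_) renaming (_-_ to _−ℚ_)
open import Data.Product using (_×_; Σ)
open import Data.Sum using (_⊎_)
open import Data.Bool using (if_then_else_)
open import Relation.Nullary using (does)
open import Relation.Binary.PropositionalEquality using (_≡_; _≢_)
open import Function.Bundles using (_⇔_)

-- Finite sets are represented as subsets of an ambient finite type Fin k.
-- A CI model over N ⊆ Fin k is a predicate on triples (i , j , K) standing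
-- for the statement ij|K; only triples that are genuine elements of 𝕊(N)
-- ("valid" triples) are ever inspected.

Model : ℕ → Set₁
Model k = Fin k → Fin k → Subset k → Set

ValidCI : ∀ {k} → Subset k → Fin k → Fin k → Subset k → Set
ValidCI N i j K = i ∈ N × j ∈ N × i ≢ j × K ⊆ N × i ∉ K × j ∉ K

-- The identification ij|K = ji|K: a model is symmetric on 𝕊(N).
IsModel : ∀ {k} → Subset k → Model k → Set
IsModel N 𝓜 = ∀ i j K → ValidCI N i j K → 𝓜 i j K → 𝓜 j i K

-- A CI frame restricted to the finite subsets of a given ambient set.
Frame : Set₁
Frame = ∀ {k} → Subset k → Model k → Set

Supermodular : ∀ {k} → Subset k → (Subset k → ℚ) → Set
Supermodular N m = ∀ A B → A ⊆ N → B ⊆ N → m A + m B ≤ m (A ∪ B) + m (A ∩ B)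

Δ : ∀ {k} → (Subset k → ℚ) → Fin k → Fin k → Subset k → ℚ
Δ m i j K = m (⁅ i ⁆ ∪ ⁅ j ⁆ ∪ K) + m K −ℚ m (⁅ i ⁆ ∪ K) −ℚ m (⁅ j ⁆ ∪ K)

𝔖str : Frame
𝔖str N 𝓜 = Σ (Subset _ → ℚ) λ m → Supermodular N m ×
  (∀ i j K → ValidCI N i j K → (𝓜 i j K ⇔ (Δ m i j K ≡ 0ℚ)))

𝔖 : Frame
𝔖 N 𝓜 = IsModel N 𝓜 ×
  (∀ i j l K → i ∈ N → j ∈ N → l ∈ N → i ≢ j → i ≢ l → j ≢ l →
     K ⊆ N → i ∉ K → j ∉ K → l ∉ K →
     ((𝓜 i j K × 𝓜 i l (⁅ j ⁆ ∪ K)) ⇔ (𝓜 i l K × 𝓜 i j (⁅ l ⁆ ∪ K))))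

Perp : ∀ {k} → Model k → Subset k → Subset k → Subset k → Set
Perp 𝓜 I J C = ∀ i j L′ → i ∈ I → j ∈ J → C ⊆ L′ →
  L′ ⊆ ((I ∪ J ∪ C) - i - j) → 𝓜 i j L′

ρ : ∀ {k} → Fin k → Fin k → Fin k → Fin k
ρ u v i = if does (i ≟ v) then u else i

ρ[_] : ∀ {k} → Fin k → Fin k → Subset k → Subset k
ρ[_] u v K = (K - v) ∪ (if does (v ∈? K) then ⁅ u ⁆ else ∅)

-- the model 𝓜_{v‖u} over N ∪ M, where L = N ∩ M
Replicate : ∀ {k} → Model k → Fin k → Fin k → Subset k → Model k
Replicate 𝓜 u v L i j K =
  (a ∈ C ⊎ b ∈ C)
  -- convention (2): ρ(i) = ρ(j) = u
  ⊎ (a ∉ C × b ∉ C × a ≡ b × Perp 𝓜 ⁅ u ⁆ (L ─ C) C)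
  ⊎ (a ∉ C × b ∉ C × a ≢ b × 𝓜 a b C)
  where
  a = ρ u v i
  b = ρ u v j
  C = ρ[ u ] v K

ClosedUnderTightReplication : Frame → Set₁
ClosedUnderTightReplication 𝔉 =
  ∀ k (N M : Subset k) (n : ℕ) → 1 Data.Nat.≤ n →
  ∣ N ∣ ≡ n → ∣ M ∣ ≡ n → ∣ N ∩ M ∣ ≡ n Data.Nat.∸ 1 →
  ∀ (u v : Fin k) → u ∈ N → u ∉ M → v ∈ M → v ∉ N →
  ∀ (𝓜 : Model k) → 𝔉 N 𝓜 → 𝔉 (N ∪ M) (Replicate 𝓜 u v (N ∩ M))
  where open import Data.Fin.Subset using (∣_∣)

{-# OPTIONS --safe #-}

-- ρ collapses the new element v onto its original u, and ij|K belongs to the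
-- replica exactly when the image statement ρ(i)ρ(j)|ρ(K) holds under the
-- conventions, so everything is read off images in N.  Distinct points collide
-- under ρ only for {i, j} = {u, v}; then K ⊆ L and uv|K is governed by
-- u ⊥ L∖K | K.
--
-- Semi-graphoids: an instance of the axiom over N ∪ M maps to an instance over N
-- unless two of its points collide.  The only genuinely new case is contraction:
-- ub|K together with u ⊥ L∖bK | bK yields u ⊥ L∖K | K, by adding the elements
-- of L to the conditioning set one at a time.
--
-- Structural semi-graphoids: if m induces 𝓜, then
--   m′(S) = m(ρS) + [u, v ∈ S] · (m(uL) − m(L))
-- induces the replica.  Away from the collision Δm′ is Δm on images; for uv|K it
-- is g(L) − g(K) with g(X) = m(uX) − m(X), which supermodularity makes monotone
-- on subsets of L, so it vanishes iff every uj|L′ with K ⊆ L′ ⊆ L holds.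
-- Supermodularity of m′ follows from that of m, except on "crossed" pairs
-- (u ∈ A ∖ B, v ∈ B ∖ A), where the same monotonicity of g pays for the extra term.
module Submission where

open import Algebra.Bundles using (CommutativeMonoid)
open import Data.Bool using (Bool; true; false; if_then_else_; _∧_; _∨_)
open import Data.Bool.Properties using (¬-not; ∧-zeroʳ)
open import Data.Empty using (⊥-elim)
open import Data.Fin using (Fin; _≟_)
open import Data.Fin.Subset
  using (Subset; _∈_; _∉_; _⊆_; _∩_; _∪_; _─_; _-_; ⁅_⁆; ∣_∣; inside; outside)
open import Data.Fin.Subset.Properties
open import Data.Nat as ℕ using (ℕ; suc)
import Data.Nat.Properties as ℕ
open import Data.Product using (_×_; _,_; proj₁; proj₂; map₂; uncurry)
open import Data.Rational using (ℚ; 0ℚ; _+_; -_; _≤_) renaming (_-_ to _−_)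
import Data.Rational.Properties as ℚ
open import Data.Rational.Solver using (module +-*-Solver)
open import Data.Sum using (_⊎_; inj₁; inj₂; [_,_]′)
open import Data.Vec.Base using ([]; _∷_; there; lookup)
open import Data.Vec.Properties using ([]=⇒lookup; lookup⇒[]=; lookup-zipWith)
open import Function using (id)
open import Function.Bundles using (_⇔_; mk⇔; Equivalence)
open import Function.Properties.Equivalence using (⇔-setoid)
open import Level using (0ℓ)
open import Relation.Binary.PropositionalEquality
  using (_≡_; _≢_; refl; sym; ≢-sym; trans; cong; cong₂; subst; subst₂; module ≡-Reasoning)
import Relation.Binary.Reasoning.Setoid as SetoidReasoning
open import Relation.Nullary using (Dec; yes; no; ¬_)
open import Relation.Nullary.Decidable using (dec-true; dec-false; _×-dec_; ¬?)

open import Defs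

open import Algebra.Properties.CommutativeSemigroup
  (CommutativeMonoid.commutativeSemigroup ℚ.+-0-commutativeMonoid)
  using () renaming (interchange to +-interchange)
open import Algebra.Properties.Group ℚ.+-0-group
  using () renaming (x∙y⁻¹≈ε⇒x≈y to x−y≡0⇒x≡y; x≈y⇒x∙y⁻¹≈ε to x≡y⇒x−y≡0)
open +-*-Solver using (solve; _:+_; _:-_; :-_; _:=_; con)

private variable
  k : ℕ
  x y : Fin k
  p q r C : Subset k
  a b c : Fin k

-- Finite subsets

x∈p─q⇒x∉q : ∀ (p q : Subset k) → x ∈ p ─ q → x ∉ q
x∈p─q⇒x∉q (_ ∷ p) (_ ∷ q) (there x∈p─q) (there x∈q) = x∈p─q⇒x∉q p q x∈p─q x∈q

private
  ∪⁻ : x ∈ p ∪ q → x ∈ p ⊎ x ∈ q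
  ∪⁻ {p = p} {q} = x∈p∪q⁻ p q

  ∪⁺ˡ : x ∈ p → x ∈ p ∪ q
  ∪⁺ˡ x∈p = x∈p∪q⁺ (inj₁ x∈p)

  ∪⁺ʳ : x ∈ q → x ∈ p ∪ q
  ∪⁺ʳ x∈q = x∈p∪q⁺ (inj₂ x∈q)

  ∩⁻ : x ∈ p ∩ q → x ∈ p × x ∈ q
  ∩⁻ {p = p} {q} = x∈p∩q⁻ p q

  ∩⁺ : x ∈ p → x ∈ q → x ∈ p ∩ q
  ∩⁺ x∈p x∈q = x∈p∩q⁺ (x∈p , x∈q)

  ─⁻ : x ∈ p ─ q → x ∈ p × x ∉ q
  ─⁻ {p = p} {q} x∈p─q = p─q⊆p p q x∈p─q , x∈p─q⇒x∉q p q x∈p─q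

  -⁻ : x ∈ p - y → x ∈ p × x ≢ y
  -⁻ x∈p-y = proj₁ (─⁻ x∈p-y) , x∉⁅y⁆⇒x≢y (proj₂ (─⁻ x∈p-y))

  ⁅⁆⁻ : x ∈ ⁅ y ⁆ → x ≡ y
  ⁅⁆⁻ {y = y} = x∈⁅y⁆⇒x≡y y

⁅x⁆∪p⊆q : x ∈ q → p ⊆ q → ⁅ x ⁆ ∪ p ⊆ q
⁅x⁆∪p⊆q {q = q} x∈q p⊆q y∈ with ∪⁻ y∈
... | inj₁ y≡x = subst (_∈ q) (sym (⁅⁆⁻ y≡x)) x∈q
... | inj₂ y∈p = p⊆q y∈p

x∉⁅y⁆∪p : x ≢ y → x ∉ p → x ∉ ⁅ y ⁆ ∪ p
x∉⁅y⁆∪p x≢y x∉p x∈ with ∪⁻ x∈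
... | inj₁ x≡y = x≢y (⁅⁆⁻ x≡y)
... | inj₂ x∈p = x∉p x∈p

x∈⁅x⁆∪p : x ∈ ⁅ x ⁆ ∪ p
x∈⁅x⁆∪p {x = x} = ∪⁺ˡ (x∈⁅x⁆ x)

⁅x⁆∪-monoʳ : p ⊆ q → ⁅ x ⁆ ∪ p ⊆ ⁅ x ⁆ ∪ q
⁅x⁆∪-monoʳ p⊆q y∈ with ∪⁻ y∈
... | inj₁ y≡x = ∪⁺ˡ y≡x
... | inj₂ y∈p = ∪⁺ʳ (p⊆q y∈p)

p⊆q⇒p∪q≡q : p ⊆ q → p ∪ q ≡ q
p⊆q⇒p∪q≡q {p = p} p⊆q = ⊆-antisym (λ x∈ → [ p⊆q , id ]′ (∪⁻ x∈)) (∪⁺ʳ {p = p})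

x∈p⇒⁅x⁆∪p≡p : x ∈ p → ⁅ x ⁆ ∪ p ≡ p
x∈p⇒⁅x⁆∪p≡p {p = p} x∈p = p⊆q⇒p∪q≡q (λ y∈ → subst (_∈ p) (sym (⁅⁆⁻ y∈)) x∈p)

⁅x⁆∪⁅y⁆∪p≡⁅y⁆∪⁅x⁆∪p : ∀ x y (p : Subset k) → ⁅ x ⁆ ∪ ⁅ y ⁆ ∪ p ≡ ⁅ y ⁆ ∪ ⁅ x ⁆ ∪ p
⁅x⁆∪⁅y⁆∪p≡⁅y⁆∪⁅x⁆∪p x y p = begin
  ⁅ x ⁆ ∪ ⁅ y ⁆ ∪ p    ≡⟨ ∪-assoc ⁅ x ⁆ ⁅ y ⁆ p ⟨
  (⁅ x ⁆ ∪ ⁅ y ⁆) ∪ p  ≡⟨ cong (_∪ p) (∪-comm ⁅ x ⁆ ⁅ y ⁆) ⟩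
  (⁅ y ⁆ ∪ ⁅ x ⁆) ∪ p  ≡⟨ ∪-assoc ⁅ y ⁆ ⁅ x ⁆ p ⟩
  ⁅ y ⁆ ∪ ⁅ x ⁆ ∪ p    ∎
  where open ≡-Reasoning

p⊆q⇒p⊆q-x : p ⊆ q → x ∉ p → p ⊆ q - x
p⊆q⇒p⊆q-x {p = p} p⊆q x∉p y∈p = x∈p∧x≢y⇒x∈p-y (p⊆q y∈p) (λ y≡x → x∉p (subst (_∈ p) y≡x y∈p))

x∈p⇒⁅x⁆∪[p-x]≡p : x ∈ p → ⁅ x ⁆ ∪ (p - x) ≡ p
x∈p⇒⁅x⁆∪[p-x]≡p {x = x} {p = p} x∈p = ⊆-antisym (⁅x⁆∪p⊆q x∈p (λ y∈ → proj₁ (-⁻ y∈))) split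
  where
  split : p ⊆ ⁅ x ⁆ ∪ (p - x)
  split {y} y∈p with y ≟ x
  ... | yes y≡x = ∪⁺ˡ (subst (_∈ ⁅ x ⁆) (sym y≡x) (x∈⁅x⁆ x))
  ... | no  y≢x = ∪⁺ʳ (x∈p∧x≢y⇒x∈p-y y∈p y≢x)

⊆-induction : ∀ (P : Subset k → Set) → P p →
  (∀ {r} {x} → p ⊆ r → r ⊆ q → x ∈ q → x ∉ r → P r → P (⁅ x ⁆ ∪ r)) →
  ∀ {r} → p ⊆ r → r ⊆ q → P r
⊆-induction {p = p} {q = q} P base step {r} = go (suc ∣ r ─ p ∣) (ℕ.n<1+n _)
  where
  go : ∀ n {r} → ∣ r ─ p ∣ ℕ.< n → p ⊆ r → r ⊆ q → P r
  go (suc n) {r} size p⊆r r⊆q with nonempty? (r ─ p)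
  ... | no r─p-empty = subst P (⊆-antisym p⊆r r⊆p) base
    where
    r⊆p : r ⊆ p
    r⊆p {x} x∈r with x ∈? p
    ... | yes x∈p = x∈p
    ... | no  x∉p = ⊥-elim (r─p-empty (x , x∈p∧x∉q⇒x∈p─q x∈r x∉p))
  ... | yes (x , x∈r─p) =
    subst P (x∈p⇒⁅x⁆∪[p-x]≡p x∈r) (step p⊆r-x r-x⊆q (r⊆q x∈r) x∉r-x (go n smaller p⊆r-x r-x⊆q))
    where
    x∈r : x ∈ r
    x∈r = proj₁ (─⁻ x∈r─p)
    p⊆r-x : p ⊆ r - x
    p⊆r-x = p⊆q⇒p⊆q-x p⊆r (proj₂ (─⁻ x∈r─p))
    r-x⊆q : r - x ⊆ q
    r-x⊆q y∈ = r⊆q (proj₁ (-⁻ y∈))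
    x∉r-x : x ∉ r - x
    x∉r-x x∈ = proj₂ (-⁻ x∈) refl
    smaller : ∣ r - x ─ p ∣ ℕ.< n
    smaller = ℕ.<-≤-trans
      (subst (λ s → ∣ s ∣ ℕ.< ∣ r ─ p ∣) (p─q─r≡p─r─q r p ⁅ x ⁆) (x∈p⇒∣p-x∣<∣p∣ x∈r─p)) (ℕ.≤-pred size)

∉⇒lookup≡false : x ∉ p → lookup p x ≡ false
∉⇒lookup≡false {x = x} {p = p} x∉p = ¬-not (λ lookup≡true → x∉p (lookup⇒[]= x p lookup≡true))

lookup≡false⇒∉ : lookup p x ≡ false → x ∉ p
lookup≡false⇒∉ lookup≡false x∈p with () ← trans (sym ([]=⇒lookup x∈p)) lookup≡false

lookup-⁅y⁆∪ : ∀ (p : Subset k) → x ≢ y → lookup (⁅ y ⁆ ∪ p) x ≡ lookup p x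
lookup-⁅y⁆∪ {x = x} {y = y} p x≢y =
  trans (lookup-zipWith _∨_ x ⁅ y ⁆ p) (cong (_∨ lookup p x) (∉⇒lookup≡false (x≢y⇒x∉⁅y⁆ x≢y)))

∣p∣≡∣p∩q∣+∣p─q∣ : ∀ (p q : Subset k) → ∣ p ∣ ≡ ∣ p ∩ q ∣ ℕ.+ ∣ p ─ q ∣
∣p∣≡∣p∩q∣+∣p─q∣ []            []            = refl
∣p∣≡∣p∩q∣+∣p─q∣ (inside ∷ p)  (inside ∷ q)  = cong suc (∣p∣≡∣p∩q∣+∣p─q∣ p q)
∣p∣≡∣p∩q∣+∣p─q∣ (inside ∷ p)  (outside ∷ q) = trans (cong suc (∣p∣≡∣p∩q∣+∣p─q∣ p q)) (sym (ℕ.+-suc _ _))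
∣p∣≡∣p∩q∣+∣p─q∣ (outside ∷ p) (inside ∷ q)  = ∣p∣≡∣p∩q∣+∣p─q∣ p q
∣p∣≡∣p∩q∣+∣p─q∣ (outside ∷ p) (outside ∷ q) = ∣p∣≡∣p∩q∣+∣p─q∣ p q

x≢y⇒2≤∣p∣ : x ∈ p → y ∈ p → x ≢ y → 2 ℕ.≤ ∣ p ∣
x≢y⇒2≤∣p∣ {x = x} {p = p} {y = y} x∈p y∈p x≢y = ℕ.≤-trans (ℕ.s≤s 1≤∣p-x∣) (x∈p⇒∣p-x∣<∣p∣ x∈p)
  where
  ⁅y⁆⊆p-x : ⁅ y ⁆ ⊆ p - x
  ⁅y⁆⊆p-x z∈ with refl ← ⁅⁆⁻ z∈ = x∈p∧x≢y⇒x∈p-y y∈p (λ y≡x → x≢y (sym y≡x))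
  1≤∣p-x∣ : 1 ℕ.≤ ∣ p - x ∣
  1≤∣p-x∣ = subst (ℕ._≤ ∣ p - x ∣) (∣⁅x⁆∣≡1 y) (p⊆q⇒∣p∣≤∣q∣ ⁅y⁆⊆p-x)

∣p∣≡1+∣p∩q∣⇒p-x⊆q : ∣ p ∣ ≡ suc ∣ p ∩ q ∣ → x ∈ p → x ∉ q → y ∈ p → y ≢ x → y ∈ q
∣p∣≡1+∣p∩q∣⇒p-x⊆q {p = p} {q = q} {y = y} ∣p∣≡ x∈p x∉q y∈p y≢x with y ∈? q
... | yes y∈q = y∈q
... | no  y∉q = ⊥-elim (2≰1 (subst (2 ℕ.≤_) ∣p─q∣≡1
                  (x≢y⇒2≤∣p∣ (x∈p∧x∉q⇒x∈p─q y∈p y∉q) (x∈p∧x∉q⇒x∈p─q x∈p x∉q) y≢x)))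
  where
  ∣p─q∣≡1 : ∣ p ─ q ∣ ≡ 1
  ∣p─q∣≡1 = ℕ.+-cancelˡ-≡ ∣ p ∩ q ∣ _ _
    (trans (sym (∣p∣≡∣p∩q∣+∣p─q∣ p q)) (trans ∣p∣≡ (ℕ.+-comm 1 ∣ p ∩ q ∣)))
  2≰1 : ¬ (2 ℕ.≤ 1)
  2≰1 (ℕ.s≤s ())

-- Set functions

a+d≤b+c⇒a−c≤b−d : ∀ a b c d → a + d ≤ b + c → a − c ≤ b − d
a+d≤b+c⇒a−c≤b−d a b c d a+d≤b+c = begin
  a − c                    ≡⟨ solve 3 (λ a c d → a :- c := (a :+ d) :+ (:- c :- d)) refl a c d ⟩
  (a + d) + (- c − d)      ≤⟨ ℚ.+-monoˡ-≤ (- c − d) a+d≤b+c ⟩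
  (b + c) + (- c − d)      ≡⟨ solve 3 (λ b c d → (b :+ c) :+ (:- c :- d) := b :- d) refl b c d ⟩
  b − d                    ∎
  where open ℚ.≤-Reasoning

gain : (Subset k → ℚ) → Fin k → Subset k → ℚ
gain m x p = m (⁅ x ⁆ ∪ p) − m p

gain-mono : ∀ (m : Subset k → ℚ) → Supermodular r m →
  x ∈ r → x ∉ q → p ⊆ q → q ⊆ r → gain m x p ≤ gain m x q
gain-mono {r = r} {x = x} {q = q} {p = p} m sm x∈r x∉q p⊆q q⊆r =
  a+d≤b+c⇒a−c≤b−d (m (⁅ x ⁆ ∪ p)) (m (⁅ x ⁆ ∪ q)) (m p) (m q)
    (subst₂ (λ s t → m (⁅ x ⁆ ∪ p) + m q ≤ m s + m t) join meet
      (sm (⁅ x ⁆ ∪ p) q (⁅x⁆∪p⊆q x∈r (λ y∈p → q⊆r (p⊆q y∈p))) q⊆r))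
  where
  join : (⁅ x ⁆ ∪ p) ∪ q ≡ ⁅ x ⁆ ∪ q
  join = trans (∪-assoc ⁅ x ⁆ p q) (cong (⁅ x ⁆ ∪_) (p⊆q⇒p∪q≡q p⊆q))
  meet⊆p : (⁅ x ⁆ ∪ p) ∩ q ⊆ p
  meet⊆p y∈ with ∪⁻ (proj₁ (∩⁻ y∈))
  ... | inj₁ y≡x = ⊥-elim (x∉q (subst (_∈ q) (⁅⁆⁻ y≡x) (proj₂ (∩⁻ y∈))))
  ... | inj₂ y∈p = y∈p
  meet : (⁅ x ⁆ ∪ p) ∩ q ≡ p
  meet = ⊆-antisym meet⊆p (λ y∈p → ∩⁺ (∪⁺ʳ y∈p) (p⊆q y∈p))

Δ≡gain−gain : ∀ (m : Subset k → ℚ) x y p → Δ m x y p ≡ gain m x (⁅ y ⁆ ∪ p) − gain m x p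
Δ≡gain−gain m x y p = solve 4 (λ a b c d → a :+ b :- c :- d := (a :- d) :- (c :- b)) refl
  (m (⁅ x ⁆ ∪ ⁅ y ⁆ ∪ p)) (m p) (m (⁅ x ⁆ ∪ p)) (m (⁅ y ⁆ ∪ p))

Δ-sym : ∀ (m : Subset k → ℚ) x y p → Δ m x y p ≡ Δ m y x p
Δ-sym m x y p = begin
  m (⁅ x ⁆ ∪ ⁅ y ⁆ ∪ p) + m p − m (⁅ x ⁆ ∪ p) − m (⁅ y ⁆ ∪ p)
    ≡⟨ cong (λ s → m s + m p − m (⁅ x ⁆ ∪ p) − m (⁅ y ⁆ ∪ p)) (⁅x⁆∪⁅y⁆∪p≡⁅y⁆∪⁅x⁆∪p x y p) ⟩
  m (⁅ y ⁆ ∪ ⁅ x ⁆ ∪ p) + m p − m (⁅ x ⁆ ∪ p) − m (⁅ y ⁆ ∪ p)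
    ≡⟨ solve 4 (λ a b c d → a :+ b :- c :- d := a :+ b :- d :- c) refl
         (m (⁅ y ⁆ ∪ ⁅ x ⁆ ∪ p)) (m p) (m (⁅ x ⁆ ∪ p)) (m (⁅ y ⁆ ∪ p)) ⟩
  m (⁅ y ⁆ ∪ ⁅ x ⁆ ∪ p) + m p − m (⁅ y ⁆ ∪ p) − m (⁅ x ⁆ ∪ p)
    ∎
  where open ≡-Reasoning

x∈p⇒Δ≡0 : ∀ (m : Subset k → ℚ) y → x ∈ p → Δ m x y p ≡ 0ℚ
x∈p⇒Δ≡0 {x = x} {p = p} m y x∈p = begin
  m (⁅ x ⁆ ∪ ⁅ y ⁆ ∪ p) + m p − m (⁅ x ⁆ ∪ p) − m (⁅ y ⁆ ∪ p)
    ≡⟨ cong₂ (λ s t → m s + m p − m t − m (⁅ y ⁆ ∪ p)) (x∈p⇒⁅x⁆∪p≡p (∪⁺ʳ x∈p)) (x∈p⇒⁅x⁆∪p≡p x∈p) ⟩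
  m (⁅ y ⁆ ∪ p) + m p − m p − m (⁅ y ⁆ ∪ p)
    ≡⟨ solve 2 (λ a b → a :+ b :- b :- a := con 0ℚ) refl (m (⁅ y ⁆ ∪ p)) (m p) ⟩
  0ℚ
    ∎
  where open ≡-Reasoning

y∈p⇒Δ≡0 : ∀ (m : Subset k → ℚ) x → y ∈ p → Δ m x y p ≡ 0ℚ
y∈p⇒Δ≡0 m x y∈p = trans (Δ-sym m x _ _) (x∈p⇒Δ≡0 m x y∈p)

Δ-+ : ∀ (f g : Subset k → ℚ) x y p → Δ (λ q → f q + g q) x y p ≡ Δ f x y p + Δ g x y p
Δ-+ f g x y p = solve 8
  (λ a b c d a′ b′ c′ d′ → (a :+ a′) :+ (b :+ b′) :- (c :+ c′) :- (d :+ d′)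
                           := (a :+ b :- c :- d) :+ (a′ :+ b′ :- c′ :- d′)) refl
  (f (⁅ x ⁆ ∪ ⁅ y ⁆ ∪ p)) (f p) (f (⁅ x ⁆ ∪ p)) (f (⁅ y ⁆ ∪ p))
  (g (⁅ x ⁆ ∪ ⁅ y ⁆ ∪ p)) (g p) (g (⁅ x ⁆ ∪ p)) (g (⁅ y ⁆ ∪ p))

Δ-diag : ∀ (m : Subset k → ℚ) x p → Δ m x x p ≡ - gain m x p
Δ-diag m x p = begin
  m (⁅ x ⁆ ∪ ⁅ x ⁆ ∪ p) + m p − m (⁅ x ⁆ ∪ p) − m (⁅ x ⁆ ∪ p)
    ≡⟨ cong (λ s → m s + m p − m (⁅ x ⁆ ∪ p) − m (⁅ x ⁆ ∪ p)) (x∈p⇒⁅x⁆∪p≡p x∈⁅x⁆∪p) ⟩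
  m (⁅ x ⁆ ∪ p) + m p − m (⁅ x ⁆ ∪ p) − m (⁅ x ⁆ ∪ p)
    ≡⟨ solve 2 (λ a b → a :+ b :- a :- a := :- (a :- b)) refl (m (⁅ x ⁆ ∪ p)) (m p) ⟩
  - gain m x p
    ∎
  where open ≡-Reasoning

Δ≡0-if-⁅y⁆∪-invariant : ∀ (m : Subset k → ℚ) x y p → (∀ q → m (⁅ y ⁆ ∪ q) ≡ m q) → Δ m x y p ≡ 0ℚ
Δ≡0-if-⁅y⁆∪-invariant m x y p invariant = begin
  m (⁅ x ⁆ ∪ ⁅ y ⁆ ∪ p) + m p − m (⁅ x ⁆ ∪ p) − m (⁅ y ⁆ ∪ p)
    ≡⟨ cong₂ (λ s t → s + m p − m (⁅ x ⁆ ∪ p) − t)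
         (trans (cong m (⁅x⁆∪⁅y⁆∪p≡⁅y⁆∪⁅x⁆∪p x y p)) (invariant (⁅ x ⁆ ∪ p))) (invariant p) ⟩
  m (⁅ x ⁆ ∪ p) + m p − m (⁅ x ⁆ ∪ p) − m p
    ≡⟨ solve 2 (λ a b → a :+ b :- a :- b := con 0ℚ) refl (m (⁅ x ⁆ ∪ p)) (m p) ⟩
  0ℚ
    ∎
  where open ≡-Reasoning

indicator-∧-modular : ∀ (c : ℚ) a b a′ b′ →
  ¬ (a ≡ true × b ≡ false × a′ ≡ false × b′ ≡ true) →
  ¬ (a ≡ false × b ≡ true × a′ ≡ true × b′ ≡ false) →
  (if (a ∨ a′) ∧ (b ∨ b′) then c else 0ℚ) + (if (a ∧ a′) ∧ (b ∧ b′) then c else 0ℚ)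
    ≡ (if a ∧ b then c else 0ℚ) + (if a′ ∧ b′ then c else 0ℚ)
indicator-∧-modular c true  true  _     _     _       _        = refl
indicator-∧-modular c false false a′    b′    _       _        = ℚ.+-comm (if a′ ∧ b′ then c else 0ℚ) 0ℚ
indicator-∧-modular c true  false true  b′    _       _        = ℚ.+-comm (if b′ then c else 0ℚ) 0ℚ
indicator-∧-modular c true  false false true  crossed _        = ⊥-elim (crossed (refl , refl , refl , refl))
indicator-∧-modular c true  false false false _       _        = refl
indicator-∧-modular c false true  true  true  _       _        = ℚ.+-comm c 0ℚ
indicator-∧-modular c false true  true  false _       crossed′ = ⊥-elim (crossed′ (refl , refl , refl , refl))
indicator-∧-modular c false true  false _     _       _        = refl

module Collapse {u v : Fin k} (u≢v : u ≢ v) where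

  ρ-v : ρ u v v ≡ u
  ρ-v = cong (if_then u else v) (dec-true (v ≟ v) refl)

  ρ-id : x ≢ v → ρ u v x ≡ x
  ρ-id {x = x} x≢v = cong (if_then u else x) (dec-false (x ≟ v) x≢v)

  ρ-u : ρ u v u ≡ u
  ρ-u = ρ-id u≢v

  ∈ρ[]⁻ : x ∈ ρ[ u ] v p → (x ∈ p × x ≢ v) ⊎ (x ≡ u × v ∈ p)
  ∈ρ[]⁻ {p = p} x∈ with v ∈? p | ∪⁻ {p = p - v} x∈
  ... | _       | inj₁ x∈p-v = inj₁ (-⁻ x∈p-v)
  ... | yes v∈p | inj₂ x∈⁅u⁆ = inj₂ (⁅⁆⁻ x∈⁅u⁆ , v∈p)
  ... | no  _   | inj₂ x∈∅   = ⊥-elim (∉⊥ x∈∅)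

  ∈ρ[]⁺ : x ∈ p → x ≢ v → x ∈ ρ[ u ] v p
  ∈ρ[]⁺ x∈p x≢v = ∪⁺ˡ (x∈p∧x≢y⇒x∈p-y x∈p x≢v)

  u∈ρ[]⁺ : v ∈ p → u ∈ ρ[ u ] v p
  u∈ρ[]⁺ {p = p} v∈p with v ∈? p
  ... | yes _   = ∪⁺ʳ {p = p - v} (x∈⁅x⁆ u)
  ... | no  v∉p = ⊥-elim (v∉p v∈p)

  ρ∈ρ[] : x ∈ p → ρ u v x ∈ ρ[ u ] v p
  ρ∈ρ[] {x = x} x∈p with x ≟ v
  ... | yes refl = u∈ρ[]⁺ x∈p
  ... | no  x≢v  = ∈ρ[]⁺ x∈p x≢v

  u∈ρ[]⁻ : u ∈ ρ[ u ] v p → u ∈ p ⊎ v ∈ p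
  u∈ρ[]⁻ u∈ with ∈ρ[]⁻ u∈
  ... | inj₁ (u∈p , _) = inj₁ u∈p
  ... | inj₂ (_ , v∈p) = inj₂ v∈p

  ρ[]-mono : p ⊆ q → ρ[ u ] v p ⊆ ρ[ u ] v q
  ρ[]-mono p⊆q x∈ with ∈ρ[]⁻ x∈
  ... | inj₁ (x∈p , x≢v) = ∈ρ[]⁺ (p⊆q x∈p) x≢v
  ... | inj₂ (refl , v∈p) = u∈ρ[]⁺ (p⊆q v∈p)

  ρ[]-∪ : ∀ p q → ρ[ u ] v (p ∪ q) ≡ ρ[ u ] v p ∪ ρ[ u ] v q
  ρ[]-∪ p q = ⊆-antisym to from
    where
    to : ρ[ u ] v (p ∪ q) ⊆ ρ[ u ] v p ∪ ρ[ u ] v q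
    to x∈ with ∈ρ[]⁻ x∈
    ... | inj₁ (x∈p∪q , x≢v) = [ (λ x∈p → ∪⁺ˡ (∈ρ[]⁺ x∈p x≢v)) , (λ x∈q → ∪⁺ʳ (∈ρ[]⁺ x∈q x≢v)) ]′ (∪⁻ x∈p∪q)
    ... | inj₂ (refl , v∈p∪q) = [ (λ v∈p → ∪⁺ˡ (u∈ρ[]⁺ v∈p)) , (λ v∈q → ∪⁺ʳ (u∈ρ[]⁺ v∈q)) ]′ (∪⁻ v∈p∪q)
    from : ρ[ u ] v p ∪ ρ[ u ] v q ⊆ ρ[ u ] v (p ∪ q)
    from x∈ = [ ρ[]-mono (p⊆p∪q q) , ρ[]-mono (q⊆p∪q p q) ]′ (∪⁻ x∈)

  ρ[]-⁅⁆ : ∀ x → ρ[ u ] v ⁅ x ⁆ ≡ ⁅ ρ u v x ⁆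
  ρ[]-⁅⁆ x = ⊆-antisym to (λ y∈ → subst (_∈ ρ[ u ] v ⁅ x ⁆) (sym (⁅⁆⁻ y∈)) (ρ∈ρ[] (x∈⁅x⁆ x)))
    where
    to : ρ[ u ] v ⁅ x ⁆ ⊆ ⁅ ρ u v x ⁆
    to y∈ with ∈ρ[]⁻ y∈
    ... | inj₁ (y∈⁅x⁆ , y≢v) with refl ← ⁅⁆⁻ y∈⁅x⁆ = subst (_∈ ⁅ ρ u v x ⁆) (ρ-id y≢v) (x∈⁅x⁆ _)
    ... | inj₂ (refl , v∈⁅x⁆) with refl ← ⁅⁆⁻ v∈⁅x⁆ = subst (_∈ ⁅ ρ u v v ⁆) ρ-v (x∈⁅x⁆ _)

  ρ[]-⁅⁆∪ : ∀ x p → ρ[ u ] v (⁅ x ⁆ ∪ p) ≡ ⁅ ρ u v x ⁆ ∪ ρ[ u ] v p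
  ρ[]-⁅⁆∪ x p = trans (ρ[]-∪ ⁅ x ⁆ p) (cong (_∪ ρ[ u ] v p) (ρ[]-⁅⁆ x))

  Δ-ρ[] : ∀ (m : Subset k → ℚ) x y p →
    Δ (λ q → m (ρ[ u ] v q)) x y p ≡ Δ m (ρ u v x) (ρ u v y) (ρ[ u ] v p)
  Δ-ρ[] m x y p rewrite ρ[]-⁅⁆∪ x (⁅ y ⁆ ∪ p) | ρ[]-⁅⁆∪ y p | ρ[]-⁅⁆∪ x p = refl

  ρ[]-id : v ∉ p → ρ[ u ] v p ≡ p
  ρ[]-id {p = p} v∉p = ⊆-antisym to (λ x∈p → ∈ρ[]⁺ x∈p (λ x≡v → v∉p (subst (_∈ p) x≡v x∈p)))
    where
    to : ρ[ u ] v p ⊆ p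
    to x∈ with ∈ρ[]⁻ x∈
    ... | inj₁ (x∈p , _) = x∈p
    ... | inj₂ (_ , v∈p) = ⊥-elim (v∉p v∈p)

  ρ[]-∩⊆ρ[]∩ρ[] : ∀ p q → ρ[ u ] v (p ∩ q) ⊆ ρ[ u ] v p ∩ ρ[ u ] v q
  ρ[]-∩⊆ρ[]∩ρ[] p q x∈ = ∩⁺ (ρ[]-mono (p∩q⊆p p q) x∈) (ρ[]-mono (p∩q⊆q p q) x∈)

  ρ[]∩ρ[]⊆⁅u⁆∪ρ[]-∩ : ∀ p q → ρ[ u ] v p ∩ ρ[ u ] v q ⊆ ⁅ u ⁆ ∪ ρ[ u ] v (p ∩ q)
  ρ[]∩ρ[]⊆⁅u⁆∪ρ[]-∩ p q {x} x∈ with x ≟ u | ∈ρ[]⁻ (proj₁ (∩⁻ x∈)) | ∈ρ[]⁻ (proj₂ (∩⁻ x∈))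
  ... | yes refl | _                  | _             = x∈⁅x⁆∪p
  ... | no  x≢u  | inj₁ (x∈p , x≢v)   | inj₁ (x∈q , _) = ∪⁺ʳ (∈ρ[]⁺ (∩⁺ x∈p x∈q) x≢v)
  ... | no  x≢u  | inj₂ (x≡u , _)     | _             = ⊥-elim (x≢u x≡u)
  ... | no  x≢u  | _                  | inj₂ (x≡u , _) = ⊥-elim (x≢u x≡u)

  ρ[]-∩ : ∀ p q → (u ∈ ρ[ u ] v p → u ∈ ρ[ u ] v q → u ∈ ρ[ u ] v (p ∩ q)) →
          ρ[ u ] v (p ∩ q) ≡ ρ[ u ] v p ∩ ρ[ u ] v q
  ρ[]-∩ p q u∈ρ[]-∩ = ⊆-antisym (ρ[]-∩⊆ρ[]∩ρ[] p q) from
    where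
    from : ρ[ u ] v p ∩ ρ[ u ] v q ⊆ ρ[ u ] v (p ∩ q)
    from x∈ with ∪⁻ (ρ[]∩ρ[]⊆⁅u⁆∪ρ[]-∩ p q x∈)
    ... | inj₁ x∈⁅u⁆ with refl ← ⁅⁆⁻ x∈⁅u⁆ = u∈ρ[]-∩ (proj₁ (∩⁻ x∈)) (proj₂ (∩⁻ x∈))
    ... | inj₂ x∈ρ[]-∩ = x∈ρ[]-∩

  ρ[]∩ρ[]≡⁅u⁆∪ρ[]-∩ : ∀ p q → u ∈ ρ[ u ] v p → u ∈ ρ[ u ] v q →
                      ρ[ u ] v p ∩ ρ[ u ] v q ≡ ⁅ u ⁆ ∪ ρ[ u ] v (p ∩ q)
  ρ[]∩ρ[]≡⁅u⁆∪ρ[]-∩ p q u∈ρ[p] u∈ρ[q] =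
    ⊆-antisym (ρ[]∩ρ[]⊆⁅u⁆∪ρ[]-∩ p q) (⁅x⁆∪p⊆q (∩⁺ u∈ρ[p] u∈ρ[q]) (ρ[]-∩⊆ρ[]∩ρ[] p q))

  ρ-collision : x ≢ y → ρ u v x ≡ ρ u v y → (x ≡ u × y ≡ v) ⊎ (x ≡ v × y ≡ u)
  ρ-collision {x = x} {y = y} x≢y ρx≡ρy = by-cases (x ≟ v) (y ≟ v)
    where
    by-cases : Dec (x ≡ v) → Dec (y ≡ v) → (x ≡ u × y ≡ v) ⊎ (x ≡ v × y ≡ u)
    by-cases (yes x≡v) (yes y≡v) = ⊥-elim (x≢y (trans x≡v (sym y≡v)))
    by-cases (yes x≡v) (no  y≢v) =
      inj₂ (x≡v , trans (sym (ρ-id y≢v)) (trans (sym ρx≡ρy) (trans (cong (ρ u v) x≡v) ρ-v)))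
    by-cases (no  x≢v) (yes y≡v) =
      inj₁ (trans (sym (ρ-id x≢v)) (trans ρx≡ρy (trans (cong (ρ u v) y≡v) ρ-v)) , y≡v)
    by-cases (no  x≢v) (no  y≢v) = ⊥-elim (x≢y (trans (sym (ρ-id x≢v)) (trans ρx≡ρy (ρ-id y≢v))))

  ρ-collision⇒u : x ≢ y → ρ u v x ≡ ρ u v y → ρ u v x ≡ u
  ρ-collision⇒u x≢y ρx≡ρy with ρ-collision x≢y ρx≡ρy
  ... | inj₁ (refl , _) = ρ-u
  ... | inj₂ (refl , _) = ρ-v

  ρ-collision-unique : ∀ {z} → x ≢ y → ρ u v x ≡ ρ u v y → z ≢ x → z ≢ y → ρ u v x ≢ ρ u v z
  ρ-collision-unique x≢y ρx≡ρy z≢x z≢y ρx≡ρz with ρ-collision x≢y ρx≡ρy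
  ... | inj₁ (refl , refl) = z≢x (sym (trans (sym ρ-u) (trans ρx≡ρz (ρ-id z≢y))))
  ... | inj₂ (refl , refl) = z≢y (sym (trans (sym ρ-v) (trans ρx≡ρz (ρ-id z≢x))))

  ρ-separated⇒off-uv : x ≢ y → ρ u v x ≢ ρ u v y → (x ≢ u × x ≢ v) ⊎ (y ≢ u × y ≢ v)
  ρ-separated⇒off-uv {x = x} {y = y} x≢y ρx≢ρy = by-cases (x ≟ u) (x ≟ v) (y ≟ u) (y ≟ v)
    where
    by-cases : Dec (x ≡ u) → Dec (x ≡ v) → Dec (y ≡ u) → Dec (y ≡ v) →
               (x ≢ u × x ≢ v) ⊎ (y ≢ u × y ≢ v)
    by-cases (no x≢u) (no x≢v) _ _ = inj₁ (x≢u , x≢v)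
    by-cases _ _ (no y≢u) (no y≢v) = inj₂ (y≢u , y≢v)
    by-cases (yes refl) _ (yes refl) _ = ⊥-elim (x≢y refl)
    by-cases _ (yes refl) _ (yes refl) = ⊥-elim (x≢y refl)
    by-cases (yes refl) _ _ (yes refl) = ⊥-elim (ρx≢ρy (trans ρ-u (sym ρ-v)))
    by-cases _ (yes refl) (yes refl) _ = ⊥-elim (ρx≢ρy (trans ρ-v (sym ρ-u)))

record TightPair (N M : Subset k) (u v : Fin k) : Set where
  field
    u∈N : u ∈ N
    u∉M : u ∉ M
    v∈M : v ∈ M
    v∉N : v ∉ N
    N-u⊆M : ∀ {x} → x ∈ N → x ≢ u → x ∈ M
    M-v⊆N : ∀ {x} → x ∈ M → x ≢ v → x ∈ N

tightPair : ∀ {N M : Subset k} {u v} n → 1 ℕ.≤ n → ∣ N ∣ ≡ n → ∣ M ∣ ≡ n → ∣ N ∩ M ∣ ≡ n ℕ.∸ 1 →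
  u ∈ N → u ∉ M → v ∈ M → v ∉ N → TightPair N M u v
tightPair {N = N} {M} (suc n) _ ∣N∣≡ ∣M∣≡ ∣N∩M∣≡ u∈N u∉M v∈M v∉N = record
  { u∈N = u∈N ; u∉M = u∉M ; v∈M = v∈M ; v∉N = v∉N
  ; N-u⊆M = ∣p∣≡1+∣p∩q∣⇒p-x⊆q (trans ∣N∣≡ (cong suc (sym ∣N∩M∣≡))) u∈N u∉M
  ; M-v⊆N = ∣p∣≡1+∣p∩q∣⇒p-x⊆q (trans ∣M∣≡ (cong suc (sym ∣M∩N∣≡))) v∈M v∉N
  }
  where
  ∣M∩N∣≡ : ∣ M ∩ N ∣ ≡ n
  ∣M∩N∣≡ = trans (cong ∣_∣ (∩-comm M N)) ∣N∩M∣≡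

closedUnderTightReplication : ∀ (𝔉 : Frame) →
  (∀ {k} {N M : Subset k} {u v} → TightPair N M u v →
     ∀ 𝓜 → 𝔉 N 𝓜 → 𝔉 (N ∪ M) (Replicate 𝓜 u v (N ∩ M))) →
  ClosedUnderTightReplication 𝔉
closedUnderTightReplication 𝔉 closed k N M n 1≤n ∣N∣≡n ∣M∣≡n ∣N∩M∣≡n-1 u v u∈N u∉M v∈M v∉N =
  closed (tightPair n 1≤n ∣N∣≡n ∣M∣≡n ∣N∩M∣≡n-1 u∈N u∉M v∈M v∉N)

module Replication {N M : Subset k} {u v : Fin k} (tight : TightPair N M u v) (𝓜 : Model k) where

  open TightPair tight

  u≢v : u ≢ v
  u≢v u≡v = v∉N (subst (_∈ N) u≡v u∈N)

  open Collapse u≢v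

  L : Subset k
  L = N ∩ M

  L⊆N : L ⊆ N
  L⊆N x∈L = proj₁ (∩⁻ x∈L)

  u∉L : u ∉ L
  u∉L u∈L = u∉M (proj₂ (∩⁻ u∈L))

  ∈L : x ∈ N → x ≢ u → x ∈ L
  ∈L x∈N x≢u = ∩⁺ x∈N (N-u⊆M x∈N x≢u)

  ⊆L : p ⊆ N → u ∉ p → p ⊆ L
  ⊆L {p = p} p⊆N u∉p x∈p = ∈L (p⊆N x∈p) (λ x≡u → u∉p (subst (_∈ p) x≡u x∈p))

  u∉⊆L : p ⊆ L → u ∉ p
  u∉⊆L p⊆L u∈p = u∉L (p⊆L u∈p)

  v∉⊆L : p ⊆ L → v ∉ p
  v∉⊆L p⊆L v∈p = v∉N (L⊆N (p⊆L v∈p))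

  u≢∈L : x ∈ L → u ≢ x
  u≢∈L x∈L u≡x = u∉L (subst (_∈ L) (sym u≡x) x∈L)

  ρ∈N : x ∈ N ∪ M → ρ u v x ∈ N
  ρ∈N {x = x} x∈N∪M with x ≟ v | ∪⁻ x∈N∪M
  ... | yes refl | _       = u∈N
  ... | no  _    | inj₁ x∈N = x∈N
  ... | no  x≢v  | inj₂ x∈M = M-v⊆N x∈M x≢v

  ρ[]⊆N : p ⊆ N ∪ M → ρ[ u ] v p ⊆ N
  ρ[]⊆N p⊆N∪M x∈ with ∈ρ[]⁻ x∈
  ... | inj₁ (x∈p , x≢v) = subst (_∈ N) (ρ-id x≢v) (ρ∈N (p⊆N∪M x∈p))
  ... | inj₂ (refl , _)  = u∈N

  ⊆L-if-u,v∉ : p ⊆ N ∪ M → u ∉ p → v ∉ p → p ⊆ L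
  ⊆L-if-u,v∉ p⊆N∪M u∉p v∉p = ⊆L (subst (_⊆ N) (ρ[]-id v∉p) (ρ[]⊆N p⊆N∪M)) u∉p

  -- Replicate 𝓜 u v L i j K unfolds to Indep (ρ u v i) (ρ u v j) (ρ[ u ] v K).
  Indep : Fin k → Fin k → Subset k → Set
  Indep a b C = (a ∈ C ⊎ b ∈ C)
    ⊎ (a ∉ C × b ∉ C × a ≡ b × Perp 𝓜 ⁅ u ⁆ (L ─ C) C)
    ⊎ (a ∉ C × b ∉ C × a ≢ b × 𝓜 a b C)

  Perpᵤ : Subset k → Set
  Perpᵤ C = ∀ j L′ → j ∈ L → j ∉ C → C ⊆ L′ → L′ ⊆ L → j ∉ L′ → 𝓜 u j L′

  Perp-range : C ⊆ L → (⁅ u ⁆ ∪ (L ─ C) ∪ C) - u ≡ L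
  Perp-range {C = C} C⊆L = ⊆-antisym to from
    where
    to : (⁅ u ⁆ ∪ (L ─ C) ∪ C) - u ⊆ L
    to x∈ with -⁻ x∈
    ... | x∈range , x≢u with ∪⁻ x∈range
    ... | inj₁ x∈⁅u⁆ = ⊥-elim (x≢u (⁅⁆⁻ x∈⁅u⁆))
    ... | inj₂ x∈[L─C]∪C = [ (λ x∈L─C → proj₁ (─⁻ x∈L─C)) , C⊆L ]′ (∪⁻ x∈[L─C]∪C)
    from : L ⊆ (⁅ u ⁆ ∪ (L ─ C) ∪ C) - u
    from {x} x∈L = x∈p∧x≢y⇒x∈p-y (∪⁺ʳ x∈[L─C]∪C) (λ x≡u → u∉L (subst (_∈ L) x≡u x∈L))
      where
      x∈[L─C]∪C : x ∈ (L ─ C) ∪ C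
      x∈[L─C]∪C with x ∈? C
      ... | yes x∈C = ∪⁺ʳ x∈C
      ... | no  x∉C = ∪⁺ˡ (x∈p∧x∉q⇒x∈p─q x∈L x∉C)

  Perp⇔Perpᵤ : C ⊆ L → Perp 𝓜 ⁅ u ⁆ (L ─ C) C ⇔ Perpᵤ C
  Perp⇔Perpᵤ {C = C} C⊆L = mk⇔ to from
    where
    to : Perp 𝓜 ⁅ u ⁆ (L ─ C) C → Perpᵤ C
    to perp j L′ j∈L j∉C C⊆L′ L′⊆L j∉L′ =
      perp u j L′ (x∈⁅x⁆ u) (x∈p∧x∉q⇒x∈p─q j∈L j∉C) C⊆L′
        (subst (λ s → L′ ⊆ s - j) (sym (Perp-range C⊆L))
          (λ x∈L′ → x∈p∧x≢y⇒x∈p-y (L′⊆L x∈L′) (λ x≡j → j∉L′ (subst (_∈ L′) x≡j x∈L′))))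
    from : Perpᵤ C → Perp 𝓜 ⁅ u ⁆ (L ─ C) C
    from perp i j L′ i∈⁅u⁆ j∈L─C C⊆L′ L′⊆range with refl ← ⁅⁆⁻ i∈⁅u⁆ =
      perp j L′ (proj₁ (─⁻ j∈L─C)) (proj₂ (─⁻ j∈L─C)) C⊆L′
        (λ x∈L′ → proj₁ (-⁻ (L′⊆L-j x∈L′))) (λ j∈L′ → proj₂ (-⁻ (L′⊆L-j j∈L′)) refl)
      where
      L′⊆L-j : L′ ⊆ L - j
      L′⊆L-j = subst (λ s → L′ ⊆ s - j) (Perp-range C⊆L) L′⊆range

  Indep-self⇔Perpᵤ : C ⊆ L → a ∉ C → Indep a a C ⇔ Perpᵤ C
  Indep-self⇔Perpᵤ {C = C} {a = a} C⊆L a∉C = mk⇔ to from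
    where
    to : Indep a a C → Perpᵤ C
    to (inj₁ (inj₁ a∈C))                   = ⊥-elim (a∉C a∈C)
    to (inj₁ (inj₂ a∈C))                   = ⊥-elim (a∉C a∈C)
    to (inj₂ (inj₁ (_ , _ , _ , perp)))    = Equivalence.to (Perp⇔Perpᵤ C⊆L) perp
    to (inj₂ (inj₂ (_ , _ , a≢a , _)))     = ⊥-elim (a≢a refl)
    from : Perpᵤ C → Indep a a C
    from perp = inj₂ (inj₁ (a∉C , a∉C , refl , Equivalence.from (Perp⇔Perpᵤ C⊆L) perp))

  Indep-distinct : a ∉ C → b ∉ C → a ≢ b → Indep a b C → 𝓜 a b C
  Indep-distinct a∉C b∉C a≢b (inj₁ (inj₁ a∈C))                = ⊥-elim (a∉C a∈C)
  Indep-distinct a∉C b∉C a≢b (inj₁ (inj₂ b∈C))                = ⊥-elim (b∉C b∈C)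
  Indep-distinct a∉C b∉C a≢b (inj₂ (inj₁ (_ , _ , a≡b , _)))  = ⊥-elim (a≢b a≡b)
  Indep-distinct a∉C b∉C a≢b (inj₂ (inj₂ (_ , _ , _ , 𝓜abC))) = 𝓜abC

  Perpᵤ⇒𝓜 : C ⊆ L → Perpᵤ C → c ∈ L → c ∉ C → 𝓜 u c C
  Perpᵤ⇒𝓜 C⊆L perp c∈L c∉C = perp _ _ c∈L c∉C id C⊆L c∉C

  Perpᵤ-⁅⁆∪ : Perpᵤ C → Perpᵤ (⁅ c ⁆ ∪ C)
  Perpᵤ-⁅⁆∪ perp j L′ j∈L j∉cC cC⊆L′ =
    perp j L′ j∈L (λ j∈C → j∉cC (∪⁺ʳ j∈C)) (λ x∈C → cC⊆L′ (∪⁺ʳ x∈C))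

  module SemiGraphoid (sg : 𝔖 N 𝓜) where

    𝓜-sym : a ∈ N → b ∈ N → a ≢ b → C ⊆ N → a ∉ C → b ∉ C → 𝓜 a b C → 𝓜 b a C
    𝓜-sym a∈N b∈N a≢b C⊆N a∉C b∉C = proj₁ sg _ _ _ (a∈N , b∈N , a≢b , C⊆N , a∉C , b∉C)

    𝓜-semigraphoid : a ∈ N → b ∈ N → c ∈ N → a ≢ b → a ≢ c → b ≢ c → C ⊆ N → a ∉ C → b ∉ C → c ∉ C →
      𝓜 a b C → 𝓜 a c (⁅ b ⁆ ∪ C) → 𝓜 a c C × 𝓜 a b (⁅ c ⁆ ∪ C)
    𝓜-semigraphoid a∈N b∈N c∈N a≢b a≢c b≢c C⊆N a∉C b∉C c∉C 𝓜abC 𝓜acbC =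
      Equivalence.to (proj₂ sg _ _ _ _ a∈N b∈N c∈N a≢b a≢c b≢c C⊆N a∉C b∉C c∉C) (𝓜abC , 𝓜acbC)

    𝓜ᵤ-semigraphoid : b ∈ L → c ∈ L → b ≢ c → C ⊆ L → b ∉ C → c ∉ C →
      𝓜 u b C → 𝓜 u c (⁅ b ⁆ ∪ C) → 𝓜 u c C × 𝓜 u b (⁅ c ⁆ ∪ C)
    𝓜ᵤ-semigraphoid b∈L c∈L b≢c C⊆L =
      𝓜-semigraphoid u∈N (L⊆N b∈L) (L⊆N c∈L) (u≢∈L b∈L) (u≢∈L c∈L) b≢c (λ x∈C → L⊆N (C⊆L x∈C))
        (u∉⊆L C⊆L)

    𝓜ᵤ-extend : C ⊆ L → b ∈ L → b ∉ C → 𝓜 u b C → Perpᵤ (⁅ b ⁆ ∪ C) →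
      ∀ {D} → C ⊆ D → D ⊆ L - b → 𝓜 u b D
    𝓜ᵤ-extend {C = C} {b = b} C⊆L b∈L b∉C 𝓜ubC perp = ⊆-induction (𝓜 u b) 𝓜ubC step
      where
      step : ∀ {D d} → C ⊆ D → D ⊆ L - b → d ∈ L - b → d ∉ D → 𝓜 u b D → 𝓜 u b (⁅ d ⁆ ∪ D)
      step {D} {d} C⊆D D⊆L-b d∈L-b d∉D 𝓜ubD =
        proj₂ (𝓜ᵤ-semigraphoid b∈L d∈L (λ b≡d → d≢b (sym b≡d)) D⊆L b∉D d∉D 𝓜ubD
                 (perp d (⁅ b ⁆ ∪ D) d∈L (x∉⁅y⁆∪p d≢b (λ d∈C → d∉D (C⊆D d∈C)))
                   (⁅x⁆∪-monoʳ C⊆D) (⁅x⁆∪p⊆q b∈L D⊆L) (x∉⁅y⁆∪p d≢b d∉D)))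
        where
        d∈L : d ∈ L
        d∈L = proj₁ (-⁻ d∈L-b)
        d≢b : d ≢ b
        d≢b = proj₂ (-⁻ d∈L-b)
        D⊆L : D ⊆ L
        D⊆L x∈D = proj₁ (-⁻ (D⊆L-b x∈D))
        b∉D : b ∉ D
        b∉D b∈D = proj₂ (-⁻ (D⊆L-b b∈D)) refl

    Perpᵤ-contract : C ⊆ L → b ∈ L → b ∉ C → 𝓜 u b C → Perpᵤ (⁅ b ⁆ ∪ C) → Perpᵤ C
    Perpᵤ-contract {b = b} C⊆L b∈L b∉C 𝓜ubC perp j L′ j∈L j∉C C⊆L′ L′⊆L j∉L′ with b ∈? L′ | j ≟ b
    ... | yes b∈L′ | _ =
      perp j L′ j∈L (x∉⁅y⁆∪p (λ j≡b → j∉L′ (subst (_∈ L′) (sym j≡b) b∈L′)) j∉C)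
        (⁅x⁆∪p⊆q b∈L′ C⊆L′) L′⊆L j∉L′
    ... | no b∉L′ | yes refl = 𝓜ᵤ-extend C⊆L b∈L b∉C 𝓜ubC perp C⊆L′ (p⊆q⇒p⊆q-x L′⊆L b∉L′)
    ... | no b∉L′ | no j≢b =
      proj₁ (𝓜ᵤ-semigraphoid b∈L j∈L (λ b≡j → j≢b (sym b≡j)) L′⊆L b∉L′ j∉L′
               (𝓜ᵤ-extend C⊆L b∈L b∉C 𝓜ubC perp C⊆L′ (p⊆q⇒p⊆q-x L′⊆L b∉L′))
               (perp j (⁅ b ⁆ ∪ L′) j∈L (x∉⁅y⁆∪p j≢b j∉C) (⁅x⁆∪-monoʳ C⊆L′)
                 (⁅x⁆∪p⊆q b∈L L′⊆L) (x∉⁅y⁆∪p j≢b j∉L′)))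

    Indep-sym : a ∈ N → b ∈ N → C ⊆ N → Indep a b C → Indep b a C
    Indep-sym _ _ _ (inj₁ (inj₁ a∈C))                        = inj₁ (inj₂ a∈C)
    Indep-sym _ _ _ (inj₁ (inj₂ b∈C))                        = inj₁ (inj₁ b∈C)
    Indep-sym _ _ _ (inj₂ (inj₁ (a∉C , b∉C , a≡b , perp)))   = inj₂ (inj₁ (b∉C , a∉C , sym a≡b , perp))
    Indep-sym a∈N b∈N C⊆N (inj₂ (inj₂ (a∉C , b∉C , a≢b , 𝓜abC))) =
      inj₂ (inj₂ (b∉C , a∉C , (λ b≡a → a≢b (sym b≡a)) , 𝓜-sym a∈N b∈N a≢b C⊆N a∉C b∉C 𝓜abC))

    Indep-semigraphoid-u≡b : C ⊆ L → c ∈ L → c ∉ C →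
      Indep u u C → Indep u c C × Indep u u (⁅ c ⁆ ∪ C)
    Indep-semigraphoid-u≡b {C = C} {c = c} C⊆L c∈L c∉C Iuu =
      inj₂ (inj₂ (u∉⊆L C⊆L , c∉C , u≢∈L c∈L , Perpᵤ⇒𝓜 C⊆L perp c∈L c∉C)) ,
      Equivalence.from (Indep-self⇔Perpᵤ cC⊆L (u∉⊆L cC⊆L)) (Perpᵤ-⁅⁆∪ perp)
      where
      cC⊆L : ⁅ c ⁆ ∪ C ⊆ L
      cC⊆L = ⁅x⁆∪p⊆q c∈L C⊆L
      perp : Perpᵤ C
      perp = Equivalence.to (Indep-self⇔Perpᵤ C⊆L (u∉⊆L C⊆L)) Iuu

    Indep-semigraphoid-u≡c : C ⊆ L → b ∈ L → b ∉ C →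
      Indep u b C → Indep u u (⁅ b ⁆ ∪ C) → Indep u u C × Indep u b (⁅ u ⁆ ∪ C)
    Indep-semigraphoid-u≡c {C = C} {b = b} C⊆L b∈L b∉C Iub Iuu =
      Equivalence.from (Indep-self⇔Perpᵤ C⊆L (u∉⊆L C⊆L))
        (Perpᵤ-contract C⊆L b∈L b∉C (Indep-distinct (u∉⊆L C⊆L) b∉C (u≢∈L b∈L) Iub)
          (Equivalence.to (Indep-self⇔Perpᵤ bC⊆L (u∉⊆L bC⊆L)) Iuu)) ,
      inj₁ (inj₁ x∈⁅x⁆∪p)
      where
      bC⊆L : ⁅ b ⁆ ∪ C ⊆ L
      bC⊆L = ⁅x⁆∪p⊆q b∈L C⊆L

    Indep-semigraphoid : a ∈ N → b ∈ N → c ∈ N → C ⊆ N →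
      (a ≡ b → a ≡ u) → (a ≡ c → a ≡ u) → (a ≡ b → a ≢ c) →
      Indep a b C → Indep a c (⁅ b ⁆ ∪ C) → Indep a c C × Indep a b (⁅ c ⁆ ∪ C)
    Indep-semigraphoid {a = a} {b = b} {c = c} {C = C} a∈N b∈N c∈N C⊆N a≡b⇒u a≡c⇒u a≡b⇒a≢c Iab Iac
      with a ∈? C | b ∈? C | c ∈? C
    ... | yes a∈C | _       | _       = inj₁ (inj₁ a∈C) , inj₁ (inj₁ (∪⁺ʳ a∈C))
    ... | no  _   | yes b∈C | _       = subst (Indep a c) (x∈p⇒⁅x⁆∪p≡p b∈C) Iac , inj₁ (inj₂ (∪⁺ʳ b∈C))
    ... | no  _   | no  _   | yes c∈C = inj₁ (inj₂ c∈C) , subst (Indep a b) (sym (x∈p⇒⁅x⁆∪p≡p c∈C)) Iab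
    ... | no  a∉C | no  b∉C | no  c∉C with a ≟ b | a ≟ c | b ≟ c
    ...   | yes refl | _        | _        with refl ← a≡b⇒u refl =
      Indep-semigraphoid-u≡b (⊆L C⊆N a∉C) (∈L c∈N (λ c≡u → a≡b⇒a≢c refl (sym c≡u))) c∉C Iab
    ...   | no  a≢b  | yes refl | _        with refl ← a≡c⇒u refl =
      Indep-semigraphoid-u≡c (⊆L C⊆N a∉C) (∈L b∈N (λ b≡u → a≢b (sym b≡u))) b∉C Iab Iac
    ...   | no  _    | no  _    | yes refl = Iab , inj₁ (inj₂ x∈⁅x⁆∪p)
    ...   | no  a≢b  | no  a≢c  | no  b≢c  =
      inj₂ (inj₂ (a∉C , c∉C , a≢c , proj₁ 𝓜-conclusion)) ,
      inj₂ (inj₂ (x∉⁅y⁆∪p a≢c a∉C , x∉⁅y⁆∪p b≢c b∉C , a≢b , proj₂ 𝓜-conclusion))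
      where
      𝓜-conclusion : 𝓜 a c C × 𝓜 a b (⁅ c ⁆ ∪ C)
      𝓜-conclusion = 𝓜-semigraphoid a∈N b∈N c∈N a≢b a≢c b≢c C⊆N a∉C b∉C c∉C
        (Indep-distinct a∉C b∉C a≢b Iab)
        (Indep-distinct (x∉⁅y⁆∪p a≢b a∉C) (x∉⁅y⁆∪p (≢-sym b≢c) c∉C) a≢c Iac)

    Replicate-semigraphoid : ∀ i j l K → i ∈ N ∪ M → j ∈ N ∪ M → l ∈ N ∪ M → i ≢ j → i ≢ l → j ≢ l →
      K ⊆ N ∪ M → Replicate 𝓜 u v L i j K → Replicate 𝓜 u v L i l (⁅ j ⁆ ∪ K) →
      Replicate 𝓜 u v L i l K × Replicate 𝓜 u v L i j (⁅ l ⁆ ∪ K)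
    Replicate-semigraphoid i j l K i∈ j∈ l∈ i≢j i≢l j≢l K⊆ Rij Ril =
      map₂ (subst (Indep (ρ u v i) (ρ u v j)) (sym (ρ[]-⁅⁆∪ l K)))
        (Indep-semigraphoid (ρ∈N i∈) (ρ∈N j∈) (ρ∈N l∈) (ρ[]⊆N K⊆)
          (ρ-collision⇒u i≢j) (ρ-collision⇒u i≢l)
          (λ ρi≡ρj → ρ-collision-unique i≢j ρi≡ρj (≢-sym i≢l) (≢-sym j≢l))
          Rij (subst (Indep (ρ u v i) (ρ u v l)) (ρ[]-⁅⁆∪ j K) Ril))

    replicate-𝔖 : 𝔖 (N ∪ M) (Replicate 𝓜 u v L)
    replicate-𝔖 = Replicate-sym , λ i j l K i∈ j∈ l∈ i≢j i≢l j≢l K⊆ _ _ _ →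
      mk⇔ (uncurry (Replicate-semigraphoid i j l K i∈ j∈ l∈ i≢j i≢l j≢l K⊆))
          (uncurry (Replicate-semigraphoid i l j K i∈ l∈ j∈ i≢l i≢j (≢-sym j≢l) K⊆))
      where
      Replicate-sym : IsModel (N ∪ M) (Replicate 𝓜 u v L)
      Replicate-sym i j K (i∈ , j∈ , _ , K⊆ , _) = Indep-sym (ρ∈N i∈) (ρ∈N j∈) (ρ[]⊆N K⊆)

  module Structural (m : Subset k → ℚ) (sm : Supermodular N m)
    (𝓜⇔Δ≡0 : ∀ i j K → ValidCI N i j K → (𝓜 i j K ⇔ (Δ m i j K ≡ 0ℚ))) where

    both : Bool → Bool → ℚ
    both s t = if s ∧ t then gain m u L else 0ℚ

    ι : Subset k → ℚ
    ι p = both (lookup p u) (lookup p v)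

    m′ : Subset k → ℚ
    m′ p = m (ρ[ u ] v p) + ι p

    ι-uv : u ∈ p → v ∈ p → ι p ≡ gain m u L
    ι-uv u∈p v∈p rewrite []=⇒lookup u∈p | []=⇒lookup v∈p = refl

    ι-u∉ : u ∉ p → ι p ≡ 0ℚ
    ι-u∉ u∉p rewrite ∉⇒lookup≡false u∉p = refl

    ι-v∉ : v ∉ p → ι p ≡ 0ℚ
    ι-v∉ {p = p} v∉p rewrite ∉⇒lookup≡false v∉p | ∧-zeroʳ (lookup p u) = refl

    ι-⁅⁆∪ : x ≢ u → x ≢ v → ι (⁅ x ⁆ ∪ p) ≡ ι p
    ι-⁅⁆∪ {p = p} x≢u x≢v = cong₂ both (lookup-⁅y⁆∪ p (≢-sym x≢u)) (lookup-⁅y⁆∪ p (≢-sym x≢v))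

    ValidCI-u : x ∈ L → p ⊆ L → x ∉ p → ValidCI N u x p
    ValidCI-u x∈L p⊆L x∉p = u∈N , L⊆N x∈L , u≢∈L x∈L , (λ y∈p → L⊆N (p⊆L y∈p)) , u∉⊆L p⊆L , x∉p

    Perpᵤ⇔gain≡ : C ⊆ L → Perpᵤ C ⇔ (gain m u L ≡ gain m u C)
    Perpᵤ⇔gain≡ {C = C} C⊆L = mk⇔ to from
      where
      to : Perpᵤ C → gain m u L ≡ gain m u C
      to perp = ⊆-induction (λ D → gain m u D ≡ gain m u C) refl step C⊆L id
        where
        step : ∀ {D d} → C ⊆ D → D ⊆ L → d ∈ L → d ∉ D →
          gain m u D ≡ gain m u C → gain m u (⁅ d ⁆ ∪ D) ≡ gain m u C
        step {D} {d} C⊆D D⊆L d∈L d∉D gainD≡gainC =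
          trans (x−y≡0⇒x≡y _ _ (trans (sym (Δ≡gain−gain m u d D)) Δ≡0)) gainD≡gainC
          where
          Δ≡0 : Δ m u d D ≡ 0ℚ
          Δ≡0 = Equivalence.to (𝓜⇔Δ≡0 u d D (ValidCI-u d∈L D⊆L d∉D))
                  (perp d D d∈L (λ d∈C → d∉D (C⊆D d∈C)) C⊆D D⊆L d∉D)
      from : gain m u L ≡ gain m u C → Perpᵤ C
      from gainL≡gainC j L′ j∈L j∉C C⊆L′ L′⊆L j∉L′ =
        Equivalence.from (𝓜⇔Δ≡0 u j L′ (ValidCI-u j∈L L′⊆L j∉L′))
          (trans (Δ≡gain−gain m u j L′) (x≡y⇒x−y≡0 (ℚ.≤-antisym upper lower)))
        where
        jL′⊆L : ⁅ j ⁆ ∪ L′ ⊆ L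
        jL′⊆L = ⁅x⁆∪p⊆q j∈L L′⊆L
        lower : gain m u L′ ≤ gain m u (⁅ j ⁆ ∪ L′)
        lower = gain-mono m sm u∈N (u∉⊆L jL′⊆L) (∪⁺ʳ {p = ⁅ j ⁆}) (λ x∈ → L⊆N (jL′⊆L x∈))
        upper : gain m u (⁅ j ⁆ ∪ L′) ≤ gain m u L′
        upper = begin
          gain m u (⁅ j ⁆ ∪ L′) ≤⟨ gain-mono m sm u∈N u∉L jL′⊆L L⊆N ⟩
          gain m u L            ≡⟨ gainL≡gainC ⟩
          gain m u C            ≤⟨ gain-mono m sm u∈N (u∉⊆L L′⊆L) C⊆L′ (λ x∈ → L⊆N (L′⊆L x∈)) ⟩
          gain m u L′           ∎
          where open ℚ.≤-Reasoning

    Indep⇔Δ≡0 : a ∈ N → b ∈ N → a ≢ b → C ⊆ N → Indep a b C ⇔ (Δ m a b C ≡ 0ℚ)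
    Indep⇔Δ≡0 {a = a} {b = b} {C = C} a∈N b∈N a≢b C⊆N with a ∈? C | b ∈? C
    ... | yes a∈C | _       = mk⇔ (λ _ → x∈p⇒Δ≡0 m b a∈C) (λ _ → inj₁ (inj₁ a∈C))
    ... | no  _   | yes b∈C = mk⇔ (λ _ → y∈p⇒Δ≡0 m a b∈C) (λ _ → inj₁ (inj₂ b∈C))
    ... | no  a∉C | no  b∉C =
      mk⇔ (λ Iab → Equivalence.to 𝓜⇔ (Indep-distinct a∉C b∉C a≢b Iab))
          (λ Δ≡0 → inj₂ (inj₂ (a∉C , b∉C , a≢b , Equivalence.from 𝓜⇔ Δ≡0)))
      where
      𝓜⇔ : 𝓜 a b C ⇔ (Δ m a b C ≡ 0ℚ)
      𝓜⇔ = 𝓜⇔Δ≡0 a b C (a∈N , b∈N , a≢b , C⊆N , a∉C , b∉C)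

    Δm′≡Δm : ∀ i j K → i ≢ j → ρ u v i ≢ ρ u v j → Δ m′ i j K ≡ Δ m (ρ u v i) (ρ u v j) (ρ[ u ] v K)
    Δm′≡Δm i j K i≢j ρi≢ρj = begin
      Δ m′ i j K
        ≡⟨ Δ-+ (λ p → m (ρ[ u ] v p)) ι i j K ⟩
      Δ (λ p → m (ρ[ u ] v p)) i j K + Δ ι i j K
        ≡⟨ cong₂ _+_ (Δ-ρ[] m i j K) Δι≡0 ⟩
      Δ m (ρ u v i) (ρ u v j) (ρ[ u ] v K) + 0ℚ
        ≡⟨ ℚ.+-identityʳ _ ⟩
      Δ m (ρ u v i) (ρ u v j) (ρ[ u ] v K)
        ∎
      where
      open ≡-Reasoning
      Δι≡0 : Δ ι i j K ≡ 0ℚ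
      Δι≡0 with ρ-separated⇒off-uv i≢j ρi≢ρj
      ... | inj₂ (j≢u , j≢v) = Δ≡0-if-⁅y⁆∪-invariant ι i j K (λ _ → ι-⁅⁆∪ j≢u j≢v)
      ... | inj₁ (i≢u , i≢v) = trans (Δ-sym ι i j K) (Δ≡0-if-⁅y⁆∪-invariant ι j i K (λ _ → ι-⁅⁆∪ i≢u i≢v))

    Δm′-uv : ∀ {K} → K ⊆ L → Δ m′ u v K ≡ gain m u L − gain m u K
    Δm′-uv {K} K⊆L = begin
      Δ m′ u v K
        ≡⟨ Δ-+ (λ p → m (ρ[ u ] v p)) ι u v K ⟩
      Δ (λ p → m (ρ[ u ] v p)) u v K + Δ ι u v K
        ≡⟨ cong₂ _+_ (trans (Δ-ρ[] m u v K) collapsed) Δι≡gain ⟩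
      - gain m u K + gain m u L
        ≡⟨ ℚ.+-comm (- gain m u K) (gain m u L) ⟩
      gain m u L − gain m u K
        ∎
      where
      open ≡-Reasoning
      u∉K : u ∉ K
      u∉K = u∉⊆L K⊆L
      v∉K : v ∉ K
      v∉K = v∉⊆L K⊆L
      collapsed : Δ m (ρ u v u) (ρ u v v) (ρ[ u ] v K) ≡ - gain m u K
      collapsed rewrite ρ-u | ρ-v | ρ[]-id v∉K = Δ-diag m u K
      Δι≡gain : Δ ι u v K ≡ gain m u L
      Δι≡gain = begin
        ι (⁅ u ⁆ ∪ ⁅ v ⁆ ∪ K) + ι K − ι (⁅ u ⁆ ∪ K) − ι (⁅ v ⁆ ∪ K)
          ≡⟨ cong₂ (λ s t → s + t − ι (⁅ u ⁆ ∪ K) − ι (⁅ v ⁆ ∪ K))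
               (ι-uv x∈⁅x⁆∪p (∪⁺ʳ x∈⁅x⁆∪p)) (ι-u∉ u∉K) ⟩
        gain m u L + 0ℚ − ι (⁅ u ⁆ ∪ K) − ι (⁅ v ⁆ ∪ K)
          ≡⟨ cong₂ (λ s t → gain m u L + 0ℚ − s − t)
               (ι-v∉ (x∉⁅y⁆∪p (≢-sym u≢v) v∉K)) (ι-u∉ (x∉⁅y⁆∪p u≢v u∉K)) ⟩
        gain m u L + 0ℚ − 0ℚ − 0ℚ
          ≡⟨ solve 1 (λ c → c :+ con 0ℚ :- con 0ℚ :- con 0ℚ := c) refl (gain m u L) ⟩
        gain m u L
          ∎

    Indep-uu⇔Δm′-uv≡0 : ∀ {K} → K ⊆ L → Indep u u K ⇔ (Δ m′ u v K ≡ 0ℚ)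
    Indep-uu⇔Δm′-uv≡0 {K} K⊆L = begin
      Indep u u K                    ≈⟨ Indep-self⇔Perpᵤ K⊆L (u∉⊆L K⊆L) ⟩
      Perpᵤ K                        ≈⟨ Perpᵤ⇔gain≡ K⊆L ⟩
      gain m u L ≡ gain m u K        ≈⟨ mk⇔ x≡y⇒x−y≡0 (x−y≡0⇒x≡y _ _) ⟩
      gain m u L − gain m u K ≡ 0ℚ   ≡⟨ cong (_≡ 0ℚ) (Δm′-uv K⊆L) ⟨
      Δ m′ u v K ≡ 0ℚ                ∎
      where open SetoidReasoning (⇔-setoid 0ℓ)

    Replicate⇔Δm′≡0 : ∀ i j K → ValidCI (N ∪ M) i j K → (Replicate 𝓜 u v L i j K ⇔ (Δ m′ i j K ≡ 0ℚ))
    Replicate⇔Δm′≡0 i j K (i∈ , j∈ , i≢j , K⊆ , i∉K , j∉K) with ρ u v i ≟ ρ u v j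
    ... | no ρi≢ρj = subst (λ z → Replicate 𝓜 u v L i j K ⇔ (z ≡ 0ℚ)) (sym (Δm′≡Δm i j K i≢j ρi≢ρj))
                       (Indep⇔Δ≡0 (ρ∈N i∈) (ρ∈N j∈) ρi≢ρj (ρ[]⊆N K⊆))
    ... | yes ρi≡ρj with ρ-collision i≢j ρi≡ρj
    ...   | inj₁ (refl , refl) = subst (_⇔ (Δ m′ u v K ≡ 0ℚ)) (sym Replicate-uv≡)
                                   (Indep-uu⇔Δm′-uv≡0 (⊆L-if-u,v∉ K⊆ i∉K j∉K))
      where
      Replicate-uv≡ : Replicate 𝓜 u v L u v K ≡ Indep u u K
      Replicate-uv≡ = trans (cong₂ (λ a b → Indep a b (ρ[ u ] v K)) ρ-u ρ-v) (cong (Indep u u) (ρ[]-id j∉K))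
    ...   | inj₂ (refl , refl) = subst₂ _⇔_ (sym Replicate-vu≡) (cong (_≡ 0ℚ) (Δ-sym m′ u v K))
                                   (Indep-uu⇔Δm′-uv≡0 (⊆L-if-u,v∉ K⊆ j∉K i∉K))
      where
      Replicate-vu≡ : Replicate 𝓜 u v L v u K ≡ Indep u u K
      Replicate-vu≡ = trans (cong₂ (λ a b → Indep a b (ρ[ u ] v K)) ρ-v ρ-u) (cong (Indep u u) (ρ[]-id i∉K))

    -- Outside crossed pairs ρ[ u ] v commutes with ∩ and ι is modular.
    Crossed : Subset k → Subset k → Set
    Crossed A B = u ∈ A × v ∉ A × u ∉ B × v ∈ B

    crossed? : ∀ A B → Dec (Crossed A B)
    crossed? A B = u ∈? A ×-dec ¬? (v ∈? A) ×-dec ¬? (u ∈? B) ×-dec v ∈? B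

    m′-supermodular-crossed : ∀ {A B} → A ⊆ N ∪ M → B ⊆ N ∪ M → Crossed A B →
      m′ A + m′ B ≤ m′ (A ∪ B) + m′ (A ∩ B)
    m′-supermodular-crossed {A} {B} A⊆ B⊆ (u∈A , v∉A , u∉B , v∈B) = begin
      m′ A + m′ B
        ≡⟨ cong₂ _+_ (trans (cong (m ρA +_) (ι-v∉ v∉A)) (ℚ.+-identityʳ (m ρA)))
                     (trans (cong (m ρB +_) (ι-u∉ u∉B)) (ℚ.+-identityʳ (m ρB))) ⟩
      m ρA + m ρB
        ≤⟨ subst (λ s → m ρA + m ρB ≤ m (ρA ∪ ρB) + m s) (ρ[]∩ρ[]≡⁅u⁆∪ρ[]-∩ A B u∈ρA u∈ρB)
             (sm ρA ρB (ρ[]⊆N A⊆) (ρ[]⊆N B⊆)) ⟩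
      m (ρA ∪ ρB) + m (⁅ u ⁆ ∪ Z)
        ≡⟨ solve 3 (λ a b z → a :+ b := a :+ (b :- z) :+ z) refl (m (ρA ∪ ρB)) (m (⁅ u ⁆ ∪ Z)) (m Z) ⟩
      m (ρA ∪ ρB) + gain m u Z + m Z
        ≤⟨ ℚ.+-monoˡ-≤ (m Z) (ℚ.+-monoʳ-≤ (m (ρA ∪ ρB)) (gain-mono m sm u∈N u∉L Z⊆L L⊆N)) ⟩
      m (ρA ∪ ρB) + gain m u L + m Z
        ≡⟨ cong₂ _+_ (cong₂ _+_ (cong m (ρ[]-∪ A B)) (ι-uv (∪⁺ˡ u∈A) (∪⁺ʳ v∈B)))
                     (trans (cong (m Z +_) (ι-u∉ u∉A∩B)) (ℚ.+-identityʳ (m Z))) ⟨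
      m′ (A ∪ B) + m′ (A ∩ B)
        ∎
      where
      open ℚ.≤-Reasoning
      ρA ρB Z : Subset k
      ρA = ρ[ u ] v A
      ρB = ρ[ u ] v B
      Z = ρ[ u ] v (A ∩ B)
      u∈ρA : u ∈ ρA
      u∈ρA = ∈ρ[]⁺ u∈A u≢v
      u∈ρB : u ∈ ρB
      u∈ρB = u∈ρ[]⁺ v∈B
      u∉A∩B : u ∉ A ∩ B
      u∉A∩B u∈A∩B = u∉B (proj₂ (∩⁻ u∈A∩B))
      v∉A∩B : v ∉ A ∩ B
      v∉A∩B v∈A∩B = v∉A (proj₁ (∩⁻ v∈A∩B))
      Z⊆L : Z ⊆ L
      Z⊆L = subst (_⊆ L) (sym (ρ[]-id v∉A∩B))
              (⊆L-if-u,v∉ (λ x∈ → A⊆ (proj₁ (∩⁻ x∈))) u∉A∩B v∉A∩B)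

    u∈ρ[]-∩-uncrossed : ∀ {A B} → ¬ Crossed A B → ¬ Crossed B A →
      u ∈ ρ[ u ] v A → u ∈ ρ[ u ] v B → u ∈ ρ[ u ] v (A ∩ B)
    u∈ρ[]-∩-uncrossed {A} {B} ¬AB ¬BA u∈ρA u∈ρB with u∈ρ[]⁻ u∈ρA | u∈ρ[]⁻ u∈ρB
    ... | inj₁ u∈A | inj₁ u∈B = ∈ρ[]⁺ (∩⁺ u∈A u∈B) u≢v
    ... | inj₂ v∈A | inj₂ v∈B = u∈ρ[]⁺ (∩⁺ v∈A v∈B)
    ... | inj₁ u∈A | inj₂ v∈B with u ∈? B | v ∈? A
    ...   | yes u∈B | _       = ∈ρ[]⁺ (∩⁺ u∈A u∈B) u≢v
    ...   | no  _   | yes v∈A = u∈ρ[]⁺ (∩⁺ v∈A v∈B)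
    ...   | no  u∉B | no  v∉A = ⊥-elim (¬AB (u∈A , v∉A , u∉B , v∈B))
    u∈ρ[]-∩-uncrossed {A} {B} ¬AB ¬BA u∈ρA u∈ρB | inj₂ v∈A | inj₁ u∈B with u ∈? A | v ∈? B
    ...   | yes u∈A | _       = ∈ρ[]⁺ (∩⁺ u∈A u∈B) u≢v
    ...   | no  _   | yes v∈B = u∈ρ[]⁺ (∩⁺ v∈A v∈B)
    ...   | no  u∉A | no  v∉B = ⊥-elim (¬BA (u∈B , v∉B , u∉A , v∈A))

    ι-modular-uncrossed : ∀ {A B} → ¬ Crossed A B → ¬ Crossed B A → ι (A ∪ B) + ι (A ∩ B) ≡ ι A + ι B
    ι-modular-uncrossed {A} {B} ¬AB ¬BA = trans
      (cong₂ _+_ (cong₂ both (lookup-zipWith _∨_ u A B) (lookup-zipWith _∨_ v A B))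
                 (cong₂ both (lookup-zipWith _∧_ u A B) (lookup-zipWith _∧_ v A B)))
      (indicator-∧-modular (gain m u L) (lookup A u) (lookup A v) (lookup B u) (lookup B v)
        (λ (Au , Av , Bu , Bv) →
           ¬AB (lookup⇒[]= u A Au , lookup≡false⇒∉ Av , lookup≡false⇒∉ Bu , lookup⇒[]= v B Bv))
        (λ (Au , Av , Bu , Bv) →
           ¬BA (lookup⇒[]= u B Bu , lookup≡false⇒∉ Bv , lookup≡false⇒∉ Au , lookup⇒[]= v A Av)))

    m′-supermodular-uncrossed : ∀ {A B} → A ⊆ N ∪ M → B ⊆ N ∪ M → ¬ Crossed A B → ¬ Crossed B A →
      m′ A + m′ B ≤ m′ (A ∪ B) + m′ (A ∩ B)
    m′-supermodular-uncrossed {A} {B} A⊆ B⊆ ¬AB ¬BA = begin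
      m′ A + m′ B
        ≡⟨ +-interchange (m ρA) (ι A) (m ρB) (ι B) ⟩
      (m ρA + m ρB) + (ι A + ι B)
        ≤⟨ ℚ.+-monoˡ-≤ (ι A + ι B) (sm ρA ρB (ρ[]⊆N A⊆) (ρ[]⊆N B⊆)) ⟩
      (m (ρA ∪ ρB) + m (ρA ∩ ρB)) + (ι A + ι B)
        ≡⟨ cong₂ (λ s t → (m s + m t) + (ι A + ι B)) (ρ[]-∪ A B) (ρ[]-∩ A B (u∈ρ[]-∩-uncrossed ¬AB ¬BA)) ⟨
      (m (ρ[ u ] v (A ∪ B)) + m (ρ[ u ] v (A ∩ B))) + (ι A + ι B)
        ≡⟨ cong ((m (ρ[ u ] v (A ∪ B)) + m (ρ[ u ] v (A ∩ B))) +_) (ι-modular-uncrossed ¬AB ¬BA) ⟨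
      (m (ρ[ u ] v (A ∪ B)) + m (ρ[ u ] v (A ∩ B))) + (ι (A ∪ B) + ι (A ∩ B))
        ≡⟨ +-interchange (m (ρ[ u ] v (A ∪ B))) (ι (A ∪ B)) (m (ρ[ u ] v (A ∩ B))) (ι (A ∩ B)) ⟨
      m′ (A ∪ B) + m′ (A ∩ B)
        ∎
      where
      open ℚ.≤-Reasoning
      ρA ρB : Subset k
      ρA = ρ[ u ] v A
      ρB = ρ[ u ] v B

    m′-supermodular : Supermodular (N ∪ M) m′
    m′-supermodular A B A⊆ B⊆ with crossed? A B | crossed? B A
    ... | yes AB  | _       = m′-supermodular-crossed A⊆ B⊆ AB
    ... | no  _   | yes BA  = subst₂ _≤_ (ℚ.+-comm (m′ B) (m′ A))
                                (cong₂ (λ s t → m′ s + m′ t) (∪-comm B A) (∩-comm B A))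
                                (m′-supermodular-crossed B⊆ A⊆ BA)
    ... | no  ¬AB | no  ¬BA = m′-supermodular-uncrossed A⊆ B⊆ ¬AB ¬BA

    replicate-𝔖str : 𝔖str (N ∪ M) (Replicate 𝓜 u v L)
    replicate-𝔖str = m′ , m′-supermodular , Replicate⇔Δm′≡0

lemma4p15 : ClosedUnderTightReplication 𝔖str × ClosedUnderTightReplication 𝔖
lemma4p15 =
  closedUnderTightReplication 𝔖str
    (λ tight 𝓜 (m , sm , 𝓜⇔Δ≡0) → Replication.Structural.replicate-𝔖str tight 𝓜 m sm 𝓜⇔Δ≡0) ,
  closedUnderTightReplication 𝔖
    (λ tight 𝓜 sg → Replication.SemiGraphoid.replicate-𝔖 tight 𝓜 sg)
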